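{- For any positive integer $n$, \[ \sum_{S\subseteq\{0,\dots,n-1\}}|S+S| = 2^n(2n-11)+\begin{cases}19\cdot 3^{(n-1)/2}, & n\text{ odd},\\ 11\cdot 3^{n/2}, & n\text{ even}.\end{cases} \]
   Context: $S+S=\{s_1+s_2: s_1,s_2\in S\}$; the sum runs over all $2^n$ subsets $S$, including the empty set (for which $|S+S|=0$). -}

module Defs where

open import Data.Nat using (ℕ; zero; suc; _+_; _*_; _^_; _∸_; _/_; _%_)
open import Data.Fin using (Fin; toℕ)
open import Data.Fin.Subset using (Subset; _∈_; ∣_∣; inside; outside)
open import Data.Fin.Subset.Properties using (_∈?_)
open import Data.Fin.Properties using (any?)
open import Data.Product using (∃; _×_; _,_)
open import Data.List using (List; []; _∷_; map; _++_)
open import Data.Nat.ListAction using (sum)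
open import Data.Vec using (Vec; _∷_; []; tabulate)
open import Relation.Binary.PropositionalEquality using (_≡_)
open import Relation.Nullary.Decidable using (Dec; _×-dec_; ⌊_⌋)
open import Data.Nat.Properties using (_≟_)

allSubsets : (n : ℕ) → List (Subset n)
allSubsets zero = [] ∷ []
allSubsets (suc n) = map (outside ∷_) (allSubsets n) ++ map (inside ∷_) (allSubsets n)

InSumset : {n : ℕ} → Subset n → ℕ → Set
InSumset {n} S t = ∃ λ (i : Fin n) → ∃ λ (j : Fin n) → (i ∈ S × j ∈ S) × (toℕ i + toℕ j ≡ t)

inSumset? : {n : ℕ} (S : Subset n) (t : ℕ) → Dec (InSumset S t)
inSumset? S t = any? λ i → any? λ j → ((i ∈? S) ×-dec (j ∈? S)) ×-dec (toℕ i + toℕ j ≟ t)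

-- S + S as a subset of {0,…,2n-1} (all sums of elements of S lie below 2n)
sumset : {n : ℕ} → Subset n → Subset (n + n)
sumset {n} S = tabulate λ (t : Fin (n + n)) → ⌊ inSumset? S (toℕ t) ⌋

sumsetTotal : ℕ → ℕ
sumsetTotal n = sum (map (λ S → ∣ sumset S ∣) (allSubsets n))

-- The case term of the formula: 19·3^((n-1)/2) for n odd, 11·3^(n/2) for n even.
-- (ℕ division is floor division, so (n-1)/2 = n/2 for odd n.)
oddEvenTerm : ℕ → ℕ
oddEvenTerm n with n % 2
... | 1 = 19 * 3 ^ ((n ∸ 1) / 2)
... | _ = 11 * 3 ^ (n / 2)

{-# OPTIONS --safe #-}
module Submission where

-- For t < 2n let avoiding n t be the number of S ⊆ {0,…,n−1} with t ∉ S + S, so that the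
-- sum is 2n·2ⁿ minus missing n = Σ_{t<2n} avoiding n t. Writing S = {0 | x} ∪ (1 + S′)
-- gives avoiding (n+1) (s+2) = avoiding n s + #{S′ : s+1 ∉ S′, s ∉ S′+S′}; toggling s+1
-- does not affect whether s ∈ S′+S′, so the last count is avoiding n s / 2 when s+1 < n
-- and avoiding n s otherwise. Hence avoiding n t = 3^⌈t/2⌉·2^(n−1−t) for t < n (each pair
-- {i, t−i} with i < t−i allows three of its four choices, t/2 is excluded, the elements
-- above t are free), and from n to n+1 both halves of the range double up to boundary
-- terms: missing (n+1) = 2·missing n + 3^⌈n/2⌉ + 2·3^⌊n/2⌋. The parity term satisfies
-- this recursion with the boundary terms subtracted, so missing n + oddEvenTerm n = 11·2ⁿ.

open import Defs

module Counting where

  open import Data.Bool.Base using (Bool; true; false; not; _∧_; _∨_; T)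
  open import Data.Bool.Properties using (T-∨; not-involutive; ∨-∧-booleanAlgebra)
  open import Algebra.Lattice.Properties.BooleanAlgebra ∨-∧-booleanAlgebra using (deMorgan₂)
  open import Data.Fin.Base using (toℕ) renaming (zero to fzero; suc to fsuc)
  open import Data.Fin.Subset using (Subset; _∈_; ∣_∣; inside; outside)
  open import Data.Fin.Subset.Properties using (drop-there)
  open import Data.List.Base using ([]; _∷_; map; _++_)
  open import Data.List.Properties using (map-++; map-∘; map-cong)
  open import Data.Nat.Base using (ℕ; zero; suc; _+_; _*_; _^_; _%_; _≤_; _<_; z≤n; s≤s; ⌊_/2⌋; ⌈_/2⌉)
  open import Data.Nat.DivMod using (m*n%n≡0; m*n/n≡m; [m+kn]%n≡m%n)
  open import Data.Nat.ListAction using (sum)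
  open import Data.Nat.ListAction.Properties using (sum-++)
  open import Data.Nat.Properties
  open import Data.Nat.Tactic.RingSolver using (solve-∀)
  open import Data.Product.Base using (∃; _×_; _,_)
  open import Data.Sum.Base using (inj₁; inj₂; [_,_]′)
  open import Data.Unit.Base using (tt)
  open import Data.Vec.Base using (_∷_; []; tabulate; here; there)
  open import Function.Base using (_∘_)
  open import Function.Bundles using (_⇔_; mk⇔; module Equivalence)
  open import Relation.Nullary.Decidable using (⌊_⌋; isYes≗does; does-⇔; toWitness; fromWitness; T?)
  open import Relation.Binary.PropositionalEquality
  open ≡-Reasoning

  open import Algebra.Properties.CommutativeSemigroup +-commutativeSemigroup using (interchange)
  open import Algebra.Properties.CommutativeSemigroup *-commutativeSemigroup using (x∙yz≈y∙xz)

  ∑< : ℕ → (ℕ → ℕ) → ℕ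
  ∑< zero    f = 0
  ∑< (suc n) f = f 0 + ∑< n (f ∘ suc)

  infix 10 ∑<
  syntax ∑< n (λ t → e) = ∑[ t < n ] e

  ∑<-cong : ∀ n {f g : ℕ → ℕ} → (∀ {t} → t < n → f t ≡ g t) → ∑< n f ≡ ∑< n g
  ∑<-cong zero    f≡g = refl
  ∑<-cong (suc n) f≡g = cong₂ _+_ (f≡g (s≤s z≤n)) (∑<-cong n (f≡g ∘ s≤s))

  ∑<-+ : ∀ n (f g : ℕ → ℕ) → ∑[ t < n ] (f t + g t) ≡ ∑< n f + ∑< n g
  ∑<-+ zero    f g = refl
  ∑<-+ (suc n) f g =
    trans (cong (f 0 + g 0 +_) (∑<-+ n (f ∘ suc) (g ∘ suc))) (interchange (f 0) (g 0) _ _)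

  ∑<-* : ∀ n k (f : ℕ → ℕ) → ∑[ t < n ] (k * f t) ≡ k * ∑< n f
  ∑<-* zero    k f = sym (*-zeroʳ k)
  ∑<-* (suc n) k f =
    trans (cong (k * f 0 +_) (∑<-* n k (f ∘ suc))) (sym (*-distribˡ-+ k (f 0) _))

  ∑<-const : ∀ n k → ∑[ _ < n ] k ≡ n * k
  ∑<-const zero    k = refl
  ∑<-const (suc n) k = cong (k +_) (∑<-const n k)

  ∑<-++ : ∀ m n (f : ℕ → ℕ) → ∑< (m + n) f ≡ ∑< m f + ∑[ u < n ] f (m + u)
  ∑<-++ zero    n f = refl
  ∑<-++ (suc m) n f = trans (cong (f 0 +_) (∑<-++ m n (f ∘ suc))) (sym (+-assoc (f 0) _ _))

  ∑<-last : ∀ n (f : ℕ → ℕ) → ∑< (suc n) f ≡ ∑< n f + f n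
  ∑<-last zero    f = +-comm (f 0) 0
  ∑<-last (suc n) f = trans (cong (f 0 +_) (∑<-last n (f ∘ suc))) (sym (+-assoc (f 0) _ _))

  ∑ₛ : (n : ℕ) → (Subset n → ℕ) → ℕ
  ∑ₛ n f = sum (map f (allSubsets n))

  infix 10 ∑ₛ
  syntax ∑ₛ n (λ S → e) = ∑[ S ⊆ n ] e

  ∑ₛ-suc : ∀ n (f : Subset (suc n) → ℕ) →
           ∑ₛ (suc n) f ≡ ∑[ S ⊆ n ] f (outside ∷ S) + ∑[ S ⊆ n ] f (inside ∷ S)
  ∑ₛ-suc n f = begin
    sum (map f (map (outside ∷_) Ss ++ map (inside ∷_) Ss))
      ≡⟨ cong sum (map-++ f (map (outside ∷_) Ss) _) ⟩
    sum (map f (map (outside ∷_) Ss) ++ map f (map (inside ∷_) Ss))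
      ≡⟨ sum-++ (map f (map (outside ∷_) Ss)) _ ⟩
    sum (map f (map (outside ∷_) Ss)) + sum (map f (map (inside ∷_) Ss))
      ≡⟨ cong₂ _+_ (cong sum (map-∘ Ss)) (cong sum (map-∘ Ss)) ⟨
    ∑[ S ⊆ n ] f (outside ∷ S) + ∑[ S ⊆ n ] f (inside ∷ S) ∎
    where Ss = allSubsets n

  ∑ₛ-cong : ∀ n {f g : Subset n → ℕ} → f ≗ g → ∑ₛ n f ≡ ∑ₛ n g
  ∑ₛ-cong n f≗g = cong sum (map-cong f≗g (allSubsets n))

  ∑ₛ-const : ∀ n k → ∑[ _ ⊆ n ] k ≡ 2 ^ n * k
  ∑ₛ-const zero    k = refl
  ∑ₛ-const (suc n) k = begin
    ∑[ _ ⊆ suc n ] k              ≡⟨ ∑ₛ-suc n _ ⟩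
    ∑[ _ ⊆ n ] k + ∑[ _ ⊆ n ] k   ≡⟨ cong₂ _+_ (∑ₛ-const n k) (∑ₛ-const n k) ⟩
    2 ^ n * k + 2 ^ n * k         ≡⟨ cong (2 ^ n * k +_) (+-identityʳ (2 ^ n * k)) ⟨
    2 * (2 ^ n * k)               ≡⟨ *-assoc 2 (2 ^ n) k ⟨
    2 ^ suc n * k                 ∎

  ∑ₛ-+ : ∀ n (f g : Subset n → ℕ) → ∑[ S ⊆ n ] (f S + g S) ≡ ∑ₛ n f + ∑ₛ n g
  ∑ₛ-+ n f g = sum-map-+ (allSubsets n)
    where
    sum-map-+ : ∀ Ss → sum (map (λ S → f S + g S) Ss) ≡ sum (map f Ss) + sum (map g Ss)
    sum-map-+ []       = refl
    sum-map-+ (S ∷ Ss) =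
      trans (cong (f S + g S +_) (sum-map-+ Ss)) (interchange (f S) (g S) _ _)

  ∑ₛ-∑<-comm : ∀ n m (f : Subset n → ℕ → ℕ) →
               ∑[ S ⊆ n ] ∑< m (f S) ≡ ∑[ t < m ] ∑[ S ⊆ n ] f S t
  ∑ₛ-∑<-comm n zero    f = trans (∑ₛ-const n 0) (*-zeroʳ (2 ^ n))
  ∑ₛ-∑<-comm n (suc m) f = trans (∑ₛ-+ n _ _)
    (cong (∑[ S ⊆ n ] f S 0 +_) (∑ₛ-∑<-comm n m (λ S → f S ∘ suc)))

  toggle : ∀ {n} → ℕ → Subset n → Subset n
  toggle k       []      = []
  toggle zero    (x ∷ S) = not x ∷ S
  toggle (suc k) (x ∷ S) = x ∷ toggle k S

  ∑ₛ-toggle : ∀ n k (f : Subset n → ℕ) → ∑[ S ⊆ n ] f (toggle k S) ≡ ∑ₛ n f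
  ∑ₛ-toggle zero    k       f = refl
  ∑ₛ-toggle (suc n) zero    f =
    trans (∑ₛ-suc n _)
      (trans (+-comm (∑[ S ⊆ n ] f (inside ∷ S)) _) (sym (∑ₛ-suc n f)))
  ∑ₛ-toggle (suc n) (suc k) f = trans (∑ₛ-suc n _)
    (trans (cong₂ _+_ (∑ₛ-toggle n k _) (∑ₛ-toggle n k _)) (sym (∑ₛ-suc n f)))

  𝟙 : Bool → ℕ
  𝟙 true  = 1
  𝟙 false = 0

  count : (n : ℕ) → (Subset n → Bool) → ℕ
  count n P = ∑[ S ⊆ n ] 𝟙 (P S)

  infix 10 count
  syntax count n (λ S → P) = #[ S ⊆ n ] P

  count-cong : ∀ n {P Q : Subset n → Bool} → P ≗ Q → count n P ≡ count n Q
  count-cong n P≗Q = ∑ₛ-cong n (cong 𝟙 ∘ P≗Q)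

  count-true : ∀ n → #[ _ ⊆ n ] true ≡ 2 ^ n
  count-true n = trans (∑ₛ-const n 1) (*-identityʳ (2 ^ n))

  count-false : ∀ n → #[ _ ⊆ n ] false ≡ 0
  count-false n = trans (∑ₛ-const n 0) (*-zeroʳ (2 ^ n))

  count-complement : ∀ n (P : Subset n → Bool) → count n P + #[ S ⊆ n ] not (P S) ≡ 2 ^ n
  count-complement n P = begin
    count n P + #[ S ⊆ n ] not (P S)       ≡⟨ ∑ₛ-+ n _ _ ⟨
    ∑[ S ⊆ n ] (𝟙 (P S) + 𝟙 (not (P S)))  ≡⟨ ∑ₛ-cong n (𝟙+𝟙-not ∘ P) ⟩
    #[ _ ⊆ n ] true                        ≡⟨ count-true n ⟩
    2 ^ n                                  ∎
    where
    𝟙+𝟙-not : ∀ b → 𝟙 b + 𝟙 (not b) ≡ 1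
    𝟙+𝟙-not true  = refl
    𝟙+𝟙-not false = refl

  count-split : ∀ n (P Q : Subset n → Bool) →
                #[ S ⊆ n ] (P S ∧ Q S) + #[ S ⊆ n ] (not (P S) ∧ Q S) ≡ count n Q
  count-split n P Q = trans (sym (∑ₛ-+ n _ _)) (∑ₛ-cong n (λ S → 𝟙-split (P S) (Q S)))
    where
    𝟙-split : ∀ a b → 𝟙 (a ∧ b) + 𝟙 (not a ∧ b) ≡ 𝟙 b
    𝟙-split true  b = +-identityʳ (𝟙 b)
    𝟙-split false b = refl

  infix 7 _∈ᵇ_

  _∈ᵇ_ : ∀ {n} → ℕ → Subset n → Bool
  k     ∈ᵇ []      = false
  zero  ∈ᵇ (x ∷ S) = x
  suc k ∈ᵇ (x ∷ S) = k ∈ᵇ S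

  ∈⇒∈ᵇ : ∀ {n} {S : Subset n} {i} → i ∈ S → T (toℕ i ∈ᵇ S)
  ∈⇒∈ᵇ here        = tt
  ∈⇒∈ᵇ (there i∈S) = ∈⇒∈ᵇ i∈S

  ∈ᵇ⇒∈ : ∀ {n} (S : Subset n) k → T (k ∈ᵇ S) → ∃ λ i → toℕ i ≡ k × i ∈ S
  ∈ᵇ⇒∈ []            k       ()
  ∈ᵇ⇒∈ (outside ∷ S) zero    ()
  ∈ᵇ⇒∈ (inside ∷ S)  zero    _   = fzero , refl , here
  ∈ᵇ⇒∈ (x ∷ S)       (suc k) k∈S with ∈ᵇ⇒∈ S k k∈S
  ... | i , refl , i∈S = fsuc i , refl , there i∈S

  ∈ᵇ-out : ∀ {n} (S : Subset n) {k} → n ≤ k → k ∈ᵇ S ≡ false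
  ∈ᵇ-out []      _         = refl
  ∈ᵇ-out (x ∷ S) (s≤s n≤k) = ∈ᵇ-out S n≤k

  ∈ᵇ-toggle : ∀ {n} (S : Subset n) {k} → k < n → k ∈ᵇ toggle k S ≡ not (k ∈ᵇ S)
  ∈ᵇ-toggle (x ∷ S) {zero}  _         = refl
  ∈ᵇ-toggle (x ∷ S) {suc k} (s≤s k<n) = ∈ᵇ-toggle S k<n

  ∈-toggle : ∀ {n} (S : Subset n) {k i} → toℕ i < k → i ∈ toggle k S ⇔ i ∈ S
  ∈-toggle (x ∷ S) {suc k} {fzero}  _         = mk⇔ (λ { here → here }) (λ { here → here })
  ∈-toggle (x ∷ S) {suc k} {fsuc i} (s≤s i<k) =
    mk⇔ (there ∘ to ∘ drop-there) (there ∘ from ∘ drop-there)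
    where open Equivalence (∈-toggle S i<k)

  count-toggle-half : ∀ n k (P : Subset n → Bool) → k < n → (∀ S → P (toggle k S) ≡ P S) →
                      2 * #[ S ⊆ n ] (not (k ∈ᵇ S) ∧ P S) ≡ count n P
  count-toggle-half n k P k<n P∘toggle≗P = begin
    2 * E                             ≡⟨ cong (E +_) (+-identityʳ E) ⟩
    E + E                             ≡⟨ cong (_+ E) E≡with ⟩
    #[ S ⊆ n ] (k ∈ᵇ S ∧ P S) + E    ≡⟨ count-split n (k ∈ᵇ_) P ⟩
    count n P                         ∎
    where
    E = #[ S ⊆ n ] (not (k ∈ᵇ S) ∧ P S)
    E≡with : E ≡ #[ S ⊆ n ] (k ∈ᵇ S ∧ P S)
    E≡with = begin
      E
        ≡⟨ ∑ₛ-toggle n k _ ⟨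
      #[ S ⊆ n ] (not (k ∈ᵇ toggle k S) ∧ P (toggle k S))
        ≡⟨ count-cong n (λ S → cong₂ _∧_
             (trans (cong not (∈ᵇ-toggle S k<n)) (not-involutive (k ∈ᵇ S))) (P∘toggle≗P S)) ⟩
      #[ S ⊆ n ] (k ∈ᵇ S ∧ P S) ∎

  inSumsetᵇ : ∀ {n} → Subset n → ℕ → Bool
  inSumsetᵇ S t = ⌊ inSumset? S t ⌋

  inSumsetᵇ-≡ : ∀ {n} {S : Subset n} {t b} → InSumset S t ⇔ T b → inSumsetᵇ S t ≡ b
  inSumsetᵇ-≡ {S = S} {t} {b} S∋t⇔b =
    trans (isYes≗does (inSumset? S t)) (does-⇔ S∋t⇔b (inSumset? S t) (T? b))

  InSumset-local : ∀ {n} {S S′ : Subset n} {k t} → (∀ {i} → toℕ i < k → i ∈ S → i ∈ S′) →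
                   t < k → InSumset S t → InSumset S′ t
  InSumset-local S⊆S′ t<k (i , j , (i∈S , j∈S) , refl) =
    i , j , (S⊆S′ (≤-<-trans (m≤m+n (toℕ i) (toℕ j)) t<k) i∈S ,
             S⊆S′ (≤-<-trans (m≤n+m (toℕ j) (toℕ i)) t<k) j∈S) , refl

  inSumsetᵇ-toggle : ∀ {n} (S : Subset n) {k t} → t < k → inSumsetᵇ (toggle k S) t ≡ inSumsetᵇ S t
  inSumsetᵇ-toggle S {t = t} t<k = inSumsetᵇ-≡ (mk⇔
    (fromWitness {a? = inSumset? S t} ∘ InSumset-local (to ∘ ∈-toggle S) t<k)
    (InSumset-local (from ∘ ∈-toggle S) t<k ∘ toWitness {a? = inSumset? S t}))
    where open Equivalence

  -- x ∷ S is {0 | x} ∪ (1 + S), whose sumset is {0 | x} ∪ (1 + S | x) ∪ (2 + (S + S)).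
  consSumsetᵇ : ∀ {n} → Bool → Subset n → ℕ → Bool
  consSumsetᵇ x S zero          = x
  consSumsetᵇ x S (suc zero)    = x ∧ 0 ∈ᵇ S
  consSumsetᵇ x S (suc (suc s)) = x ∧ suc s ∈ᵇ S ∨ inSumsetᵇ S s

  InSumset-∷-suc : ∀ {n} {S : Subset n} {k} → T (k ∈ᵇ S) → InSumset (inside ∷ S) (suc k)
  InSumset-∷-suc {S = S} {k} k∈S with ∈ᵇ⇒∈ S k k∈S
  ... | j , refl , j∈S = fzero , fsuc j , (here , there j∈S) , refl

  InSumset-∷-suc-suc : ∀ {n} {S : Subset n} {x s} → InSumset S s → InSumset (x ∷ S) (suc (suc s))
  InSumset-∷-suc-suc (i , j , (i∈S , j∈S) , refl) =
    fsuc i , fsuc j , (there i∈S , there j∈S) , cong suc (+-suc (toℕ i) (toℕ j))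

  InSumset-∷⁺ : ∀ {n} x (S : Subset n) t → T (consSumsetᵇ x S t) → InSumset (x ∷ S) t
  InSumset-∷⁺ true  S zero          _ = fzero , fzero , (here , here) , refl
  InSumset-∷⁺ true  S (suc zero)    h = InSumset-∷-suc h
  InSumset-∷⁺ true  S (suc (suc s)) h =
    [ InSumset-∷-suc , InSumset-∷-suc-suc ∘ toWitness {a? = inSumset? S s} ]′
    (Equivalence.to (T-∨ {suc s ∈ᵇ S} {inSumsetᵇ S s}) h)
  InSumset-∷⁺ false S (suc (suc s)) h = InSumset-∷-suc-suc (toWitness {a? = inSumset? S s} h)

  ∈ᵇ⇒consSumsetᵇ : ∀ {n} {S : Subset n} k → T (k ∈ᵇ S) → T (consSumsetᵇ true S (suc k))
  ∈ᵇ⇒consSumsetᵇ         zero    k∈S = k∈S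
  ∈ᵇ⇒consSumsetᵇ {S = S} (suc k) k∈S = Equivalence.from (T-∨ {suc k ∈ᵇ S} {inSumsetᵇ S k}) (inj₁ k∈S)

  InSumset⇒consSumsetᵇ : ∀ {n} {S : Subset n} x {s} → InSumset S s → T (consSumsetᵇ x S (suc (suc s)))
  InSumset⇒consSumsetᵇ {S = S} x {s} s∈S+S =
    Equivalence.from (T-∨ {x ∧ suc s ∈ᵇ S} {inSumsetᵇ S s}) (inj₂ (fromWitness {a? = inSumset? S s} s∈S+S))

  InSumset-∷⁻ : ∀ {n} x (S : Subset n) t → InSumset (x ∷ S) t → T (consSumsetᵇ x S t)
  InSumset-∷⁻ _ S _ (fzero , fzero , (here , here) , refl) = tt
  InSumset-∷⁻ _ S _ (fzero , fsuc j , (here , there j∈S) , refl) = ∈ᵇ⇒consSumsetᵇ (toℕ j) (∈⇒∈ᵇ j∈S)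
  InSumset-∷⁻ _ S _ (fsuc i , fzero , (there i∈S , here) , refl) =
    subst (λ k → T (consSumsetᵇ true S (suc k))) (sym (+-identityʳ (toℕ i)))
      (∈ᵇ⇒consSumsetᵇ (toℕ i) (∈⇒∈ᵇ i∈S))
  InSumset-∷⁻ x S _ (fsuc i , fsuc j , (there i∈S , there j∈S) , refl) =
    subst (λ k → T (consSumsetᵇ x S (suc k))) (sym (+-suc (toℕ i) (toℕ j)))
      (InSumset⇒consSumsetᵇ x (i , j , (i∈S , j∈S) , refl))

  inSumsetᵇ-∷ : ∀ {n} x (S : Subset n) t → inSumsetᵇ (x ∷ S) t ≡ consSumsetᵇ x S t
  inSumsetᵇ-∷ x S t = inSumsetᵇ-≡ (mk⇔ (InSumset-∷⁻ x S t) (InSumset-∷⁺ x S t))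

  ∣tabulate∣ : ∀ m (f : ℕ → Bool) → ∣ tabulate {n = m} (f ∘ toℕ) ∣ ≡ ∑[ t < m ] 𝟙 (f t)
  ∣tabulate∣ zero    f = refl
  ∣tabulate∣ (suc m) f with f 0 | ∣tabulate∣ m (f ∘ suc)
  ... | true  | ih = cong suc ih
  ... | false | ih = ih

  avoiding : ℕ → ℕ → ℕ
  avoiding n t = #[ S ⊆ n ] not (inSumsetᵇ S t)

  missing : ℕ → ℕ
  missing n = ∑[ t < n + n ] avoiding n t

  sumsetTotal+missing : ∀ n → sumsetTotal n + missing n ≡ (n + n) * 2 ^ n
  sumsetTotal+missing n = begin
    ∑[ S ⊆ n ] ∣ sumset S ∣ + missing n
      ≡⟨ cong (_+ missing n) (∑ₛ-cong n (λ S → ∣tabulate∣ (n + n) (inSumsetᵇ S))) ⟩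
    ∑[ S ⊆ n ] ∑[ t < n + n ] 𝟙 (inSumsetᵇ S t) + missing n
      ≡⟨ cong (_+ missing n) (∑ₛ-∑<-comm n (n + n) _) ⟩
    ∑[ t < n + n ] #[ S ⊆ n ] inSumsetᵇ S t + missing n
      ≡⟨ ∑<-+ (n + n) _ _ ⟨
    ∑[ t < n + n ] (#[ S ⊆ n ] inSumsetᵇ S t + avoiding n t)
      ≡⟨ ∑<-cong (n + n) (λ {t} _ → count-complement n (λ S → inSumsetᵇ S t)) ⟩
    ∑[ _ < n + n ] (2 ^ n)
      ≡⟨ ∑<-const (n + n) (2 ^ n) ⟩
    (n + n) * 2 ^ n ∎

  avoiding-suc : ∀ n t → avoiding (suc n) t ≡
                 #[ S ⊆ n ] not (consSumsetᵇ false S t) + #[ S ⊆ n ] not (consSumsetᵇ true S t)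
  avoiding-suc n t = trans (∑ₛ-suc n _) (cong₂ _+_
    (count-cong n (λ S → cong not (inSumsetᵇ-∷ false S t)))
    (count-cong n (λ S → cong not (inSumsetᵇ-∷ true S t))))

  avoiding-zero : ∀ n → avoiding (suc n) 0 ≡ 2 ^ n
  avoiding-zero n = begin
    avoiding (suc n) 0                   ≡⟨ avoiding-suc n 0 ⟩
    #[ _ ⊆ n ] true + #[ _ ⊆ n ] false   ≡⟨ cong₂ _+_ (count-true n) (count-false n) ⟩
    2 ^ n + 0                            ≡⟨ +-identityʳ (2 ^ n) ⟩
    2 ^ n                                ∎

  count-∌0 : ∀ n → #[ S ⊆ suc n ] not (0 ∈ᵇ S) ≡ 2 ^ n
  count-∌0 n = begin
    #[ S ⊆ suc n ] not (0 ∈ᵇ S)          ≡⟨ ∑ₛ-suc n _ ⟩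
    #[ _ ⊆ n ] true + #[ _ ⊆ n ] false   ≡⟨ cong₂ _+_ (count-true n) (count-false n) ⟩
    2 ^ n + 0                            ≡⟨ +-identityʳ (2 ^ n) ⟩
    2 ^ n                                ∎

  avoiding-one : ∀ n → avoiding (suc n) 1 ≡ 2 ^ n + #[ S ⊆ n ] not (0 ∈ᵇ S)
  avoiding-one n = trans (avoiding-suc n 1) (cong (_+ #[ S ⊆ n ] not (0 ∈ᵇ S)) (count-true n))

  avoiding-suc-suc : ∀ n s → avoiding (suc n) (suc (suc s)) ≡
                     avoiding n s + #[ S ⊆ n ] (not (suc s ∈ᵇ S) ∧ not (inSumsetᵇ S s))
  avoiding-suc-suc n s = trans (avoiding-suc n (suc (suc s)))
    (cong (avoiding n s +_) (count-cong n (λ S → deMorgan₂ (suc s ∈ᵇ S) (inSumsetᵇ S s))))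

  avoiding-low-step : ∀ n s → suc (suc s) ≤ n → 2 * avoiding (suc n) (suc (suc s)) ≡ 3 * avoiding n s
  avoiding-low-step n s s+1<n = begin
    2 * avoiding (suc n) (suc (suc s))  ≡⟨ cong (2 *_) (avoiding-suc-suc n s) ⟩
    2 * (avoiding n s + E)              ≡⟨ *-distribˡ-+ 2 (avoiding n s) E ⟩
    2 * avoiding n s + 2 * E            ≡⟨ cong (2 * avoiding n s +_) E-half ⟩
    2 * avoiding n s + avoiding n s     ≡⟨ +-comm (2 * avoiding n s) (avoiding n s) ⟩
    3 * avoiding n s                    ∎
    where
    E = #[ S ⊆ n ] (not (suc s ∈ᵇ S) ∧ not (inSumsetᵇ S s))
    E-half : 2 * E ≡ avoiding n s
    E-half = count-toggle-half n (suc s) (λ S → not (inSumsetᵇ S s)) s+1<n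
               (λ S → cong not (inSumsetᵇ-toggle S ≤-refl))

  avoiding-high-step : ∀ n s → n ≤ suc s → avoiding (suc n) (suc (suc s)) ≡ 2 * avoiding n s
  avoiding-high-step n s n≤s+1 = trans (avoiding-suc-suc n s) (cong (avoiding n s +_) (begin
    #[ S ⊆ n ] (not (suc s ∈ᵇ S) ∧ not (inSumsetᵇ S s))
      ≡⟨ count-cong n (λ S → cong (λ b → not b ∧ not (inSumsetᵇ S s)) (∈ᵇ-out S n≤s+1)) ⟩
    avoiding n s
      ≡⟨ +-identityʳ (avoiding n s) ⟨
    avoiding n s + 0 ∎))

  avoiding-below : ∀ t r → avoiding (suc (t + r)) t ≡ 3 ^ ⌈ t /2⌉ * 2 ^ r
  avoiding-below zero          r = trans (avoiding-zero r) (sym (*-identityˡ (2 ^ r)))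
  avoiding-below (suc zero)    r = begin
    avoiding (suc (suc r)) 1                       ≡⟨ avoiding-one (suc r) ⟩
    2 ^ suc r + #[ S ⊆ suc r ] not (0 ∈ᵇ S)        ≡⟨ cong (2 ^ suc r +_) (count-∌0 r) ⟩
    2 * 2 ^ r + 2 ^ r                              ≡⟨ +-comm (2 * 2 ^ r) (2 ^ r) ⟩
    3 * 2 ^ r                                      ∎
  avoiding-below (suc (suc s)) r = *-cancelˡ-≡ _ _ 2 (begin
    2 * avoiding (suc (suc (suc (s + r)))) (suc (suc s))
      ≡⟨ avoiding-low-step (suc (suc (s + r))) s (s≤s (s≤s (m≤m+n s r))) ⟩
    3 * avoiding (suc (suc (s + r))) s
      ≡⟨ cong (λ m → 3 * avoiding (suc m) s) (+-suc s r) ⟨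
    3 * avoiding (suc (s + suc r)) s
      ≡⟨ cong (3 *_) (avoiding-below s (suc r)) ⟩
    3 * (3 ^ ⌈ s /2⌉ * (2 * 2 ^ r))
      ≡⟨ regroup (3 ^ ⌈ s /2⌉) (2 ^ r) ⟩
    2 * (3 * 3 ^ ⌈ s /2⌉ * 2 ^ r) ∎)
    where
    regroup : ∀ c x → 3 * (c * (2 * x)) ≡ 2 * (3 * c * x)
    regroup = solve-∀

  avoiding-suc-below : ∀ {n t} → t < n → avoiding (suc n) t ≡ 2 * avoiding n t
  avoiding-suc-below {t = t} t<n with m≤n⇒∃[o]m+o≡n t<n
  ... | r , refl = begin
    avoiding (suc (suc (t + r))) t   ≡⟨ cong (λ m → avoiding (suc m) t) (+-suc t r) ⟨
    avoiding (suc (t + suc r)) t     ≡⟨ avoiding-below t (suc r) ⟩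
    3 ^ ⌈ t /2⌉ * (2 * 2 ^ r)       ≡⟨ x∙yz≈y∙xz (3 ^ ⌈ t /2⌉) 2 (2 ^ r) ⟩
    2 * (3 ^ ⌈ t /2⌉ * 2 ^ r)       ≡⟨ cong (2 *_) (avoiding-below t r) ⟨
    2 * avoiding (suc (t + r)) t     ∎

  avoiding-diagonal : ∀ n → avoiding (suc n) n ≡ 3 ^ ⌈ n /2⌉
  avoiding-diagonal n = begin
    avoiding (suc n) n           ≡⟨ cong (λ m → avoiding (suc m) n) (+-identityʳ n) ⟨
    avoiding (suc (n + 0)) n     ≡⟨ avoiding-below n 0 ⟩
    3 ^ ⌈ n /2⌉ * 1              ≡⟨ *-identityʳ (3 ^ ⌈ n /2⌉) ⟩
    3 ^ ⌈ n /2⌉                  ∎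

  avoiding-suc-diagonal : ∀ n → avoiding (suc n) (suc n) ≡ 2 * 3 ^ ⌊ n /2⌋
  avoiding-suc-diagonal zero    = refl
  avoiding-suc-diagonal (suc n) =
    trans (avoiding-high-step (suc n) n ≤-refl) (cong (2 *_) (avoiding-diagonal n))

  missing-lower-suc : ∀ n → ∑< (suc n) (avoiding (suc n)) ≡ 2 * ∑< n (avoiding n) + 3 ^ ⌈ n /2⌉
  missing-lower-suc n = begin
    ∑< (suc n) (avoiding (suc n))                   ≡⟨ ∑<-last n (avoiding (suc n)) ⟩
    ∑< n (avoiding (suc n)) + avoiding (suc n) n    ≡⟨ cong₂ _+_ (∑<-cong n avoiding-suc-below)
                                                                 (avoiding-diagonal n) ⟩
    ∑[ t < n ] (2 * avoiding n t) + 3 ^ ⌈ n /2⌉     ≡⟨ cong (_+ 3 ^ ⌈ n /2⌉) (∑<-* n 2 (avoiding n)) ⟩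
    2 * ∑< n (avoiding n) + 3 ^ ⌈ n /2⌉             ∎

  missing-upper-suc : ∀ n → ∑[ u < suc n ] avoiding (suc n) (suc n + u) ≡
                            2 * 3 ^ ⌊ n /2⌋ + 2 * ∑[ u < n ] avoiding n (n + u)
  missing-upper-suc n = cong₂ _+_
    (trans (cong (avoiding (suc n) ∘ suc) (+-identityʳ n)) (avoiding-suc-diagonal n))
    (trans (∑<-cong n (λ {u} _ → shifted u)) (∑<-* n 2 (λ u → avoiding n (n + u))))
    where
    shifted : ∀ u → avoiding (suc n) (suc n + suc u) ≡ 2 * avoiding n (n + u)
    shifted u = trans (cong (avoiding (suc n) ∘ suc) (+-suc n u))
                      (avoiding-high-step n (n + u) (m≤n⇒m≤1+n (m≤m+n n u)))

  missing-suc : ∀ n → missing (suc n) ≡ 2 * missing n + 3 ^ ⌈ n /2⌉ + 2 * 3 ^ ⌊ n /2⌋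
  missing-suc n = begin
    missing (suc n)
      ≡⟨ ∑<-++ (suc n) (suc n) (avoiding (suc n)) ⟩
    ∑< (suc n) (avoiding (suc n)) + ∑[ u < suc n ] avoiding (suc n) (suc n + u)
      ≡⟨ cong₂ _+_ (missing-lower-suc n) (missing-upper-suc n) ⟩
    2 * lower + 3 ^ ⌈ n /2⌉ + (2 * 3 ^ ⌊ n /2⌋ + 2 * upper)
      ≡⟨ regroup lower upper (3 ^ ⌈ n /2⌉) (3 ^ ⌊ n /2⌋) ⟩
    2 * (lower + upper) + 3 ^ ⌈ n /2⌉ + 2 * 3 ^ ⌊ n /2⌋
      ≡⟨ cong (λ m → 2 * m + 3 ^ ⌈ n /2⌉ + 2 * 3 ^ ⌊ n /2⌋) (∑<-++ n n (avoiding n)) ⟨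
    2 * missing n + 3 ^ ⌈ n /2⌉ + 2 * 3 ^ ⌊ n /2⌋ ∎
    where
    lower = ∑< n (avoiding n)
    upper = ∑[ u < n ] avoiding n (n + u)
    regroup : ∀ l u a b → 2 * l + a + (2 * b + 2 * u) ≡ 2 * (l + u) + a + 2 * b
    regroup = solve-∀

  data EvenOdd : ℕ → Set where
    even : ∀ k → EvenOdd (k * 2)
    odd  : ∀ k → EvenOdd (suc (k * 2))

  evenOdd : ∀ n → EvenOdd n
  evenOdd zero = even 0
  evenOdd (suc n) with evenOdd n
  ... | even k = odd k
  ... | odd  k = even (suc k)

  ⌊n*2/2⌋≡n : ∀ n → ⌊ n * 2 /2⌋ ≡ n
  ⌊n*2/2⌋≡n zero    = refl
  ⌊n*2/2⌋≡n (suc n) = cong suc (⌊n*2/2⌋≡n n)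

  ⌈n*2/2⌉≡n : ∀ n → ⌈ n * 2 /2⌉ ≡ n
  ⌈n*2/2⌉≡n zero    = refl
  ⌈n*2/2⌉≡n (suc n) = cong suc (⌈n*2/2⌉≡n n)

  oddEvenTerm-even : ∀ k → oddEvenTerm (k * 2) ≡ 11 * 3 ^ k
  oddEvenTerm-even k with (k * 2) % 2 | m*n%n≡0 k 2
  ... | .0 | refl = cong (λ e → 11 * 3 ^ e) (m*n/n≡m k 2)

  oddEvenTerm-odd : ∀ k → oddEvenTerm (suc (k * 2)) ≡ 19 * 3 ^ k
  oddEvenTerm-odd k with suc (k * 2) % 2 | [m+kn]%n≡m%n 1 k 2
  ... | .1 | refl = cong (λ e → 19 * 3 ^ e) (m*n/n≡m k 2)

  oddEvenTerm-step : ∀ n → oddEvenTerm (suc n) + 3 ^ ⌈ n /2⌉ + 2 * 3 ^ ⌊ n /2⌋ ≡ 2 * oddEvenTerm n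
  oddEvenTerm-step n with evenOdd n
  ... | even k rewrite oddEvenTerm-odd k | oddEvenTerm-even k | ⌈n*2/2⌉≡n k | ⌊n*2/2⌋≡n k =
    even-case (3 ^ k)
    where
    even-case : ∀ x → 19 * x + x + 2 * x ≡ 2 * (11 * x)
    even-case = solve-∀
  ... | odd k rewrite oddEvenTerm-even (suc k) | oddEvenTerm-odd k | ⌊n*2/2⌋≡n k | ⌈n*2/2⌉≡n k =
    odd-case (3 ^ k)
    where
    odd-case : ∀ x → 11 * (3 * x) + 3 * x + 2 * x ≡ 2 * (19 * x)
    odd-case = solve-∀

  missing+oddEvenTerm : ∀ n → missing n + oddEvenTerm n ≡ 11 * 2 ^ n
  missing+oddEvenTerm zero    = refl
  missing+oddEvenTerm (suc n) = begin
    missing (suc n) + oddEvenTerm (suc n)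
      ≡⟨ cong (_+ oddEvenTerm (suc n)) (missing-suc n) ⟩
    2 * missing n + 3 ^ ⌈ n /2⌉ + 2 * 3 ^ ⌊ n /2⌋ + oddEvenTerm (suc n)
      ≡⟨ regroup (missing n) (3 ^ ⌈ n /2⌉) (3 ^ ⌊ n /2⌋) (oddEvenTerm (suc n)) ⟩
    2 * missing n + (oddEvenTerm (suc n) + 3 ^ ⌈ n /2⌉ + 2 * 3 ^ ⌊ n /2⌋)
      ≡⟨ cong (2 * missing n +_) (oddEvenTerm-step n) ⟩
    2 * missing n + 2 * oddEvenTerm n
      ≡⟨ *-distribˡ-+ 2 (missing n) (oddEvenTerm n) ⟨
    2 * (missing n + oddEvenTerm n)
      ≡⟨ cong (2 *_) (missing+oddEvenTerm n) ⟩
    2 * (11 * 2 ^ n)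
      ≡⟨ x∙yz≈y∙xz 2 11 (2 ^ n) ⟩
    11 * 2 ^ suc n ∎
    where
    regroup : ∀ m a b o → 2 * m + a + 2 * b + o ≡ 2 * m + (o + a + 2 * b)
    regroup = solve-∀

open Counting using (sumsetTotal+missing; missing+oddEvenTerm)

import Data.Nat.Base as ℕ
open import Data.Nat.Base using (ℕ; _^_; _≥_)
open import Data.Integer.Base using (+_; _+_; _-_; _*_)
open import Data.Integer.Properties using (pos-+; pos-*)
open import Data.Integer.Tactic.RingSolver using (solve-∀)
open import Relation.Binary.PropositionalEquality using (_≡_; refl; cong; cong₂; trans; module ≡-Reasoning)
open ≡-Reasoning

subtract-common : ∀ {x y z a b : ℕ} → x ℕ.+ y ≡ a → y ℕ.+ z ≡ b → + x ≡ + a - + b + + z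
subtract-common {x} {y} {z} refl refl = begin
  + x                                ≡⟨ cancel (+ x) (+ y) (+ z) ⟩
  + x + + y - (+ y + + z) + + z      ≡⟨ cong₂ (λ p q → p - q + + z) (pos-+ x y) (pos-+ y z) ⟨
  + (x ℕ.+ y) - + (y ℕ.+ z) + + z    ∎
  where
  cancel : ∀ x y z → x ≡ x + y - (y + z) + z
  cancel = solve-∀

-- The identity also holds for n = 0, where both sides vanish.
theorem17 : ∀ (n : ℕ) → n ≥ 1 →
    + sumsetTotal n ≡ + (2 ^ n) * (+ 2 * + n - + 11) + + oddEvenTerm n
theorem17 n _ = begin
  + sumsetTotal n
    ≡⟨ subtract-common (sumsetTotal+missing n) (missing+oddEvenTerm n) ⟩
  + ((n ℕ.+ n) ℕ.* 2 ^ n) - + (11 ℕ.* 2 ^ n) + + oddEvenTerm n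
    ≡⟨ cong₂ (λ a b → a - b + + oddEvenTerm n)
         (trans (pos-* (n ℕ.+ n) (2 ^ n)) (cong (_* + (2 ^ n)) (pos-+ n n))) (pos-* 11 (2 ^ n)) ⟩
  (+ n + + n) * + (2 ^ n) - + 11 * + (2 ^ n) + + oddEvenTerm n
    ≡⟨ regroup (+ n) (+ (2 ^ n)) (+ oddEvenTerm n) ⟩
  + (2 ^ n) * (+ 2 * + n - + 11) + + oddEvenTerm n ∎
  where
  regroup : ∀ m p o → (m + m) * p - + 11 * p + o ≡ p * (+ 2 * m - + 11) + o
  regroup = solve-∀
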